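{- Let $a=2$, let $b$ be an arbitrary real number, and let $(M_{p_n})_{n\ge0}$ be the sequence of bi-periodic Padovan matrices (defined in the context). Then for all $n,m\in\mathbb{N}$, $$M_{p_n}\cdot M_{p_m}=M_{p_m}\cdot M_{p_n}.$$
   Context: For real numbers $a,b$, the sequence $(M_{p_n})_{n\ge0}$ of $3\times 3$ real matrices (bi-periodic Padovan matrices) is defined by $$M_{p_0}=I_3,\quad M_{p_1}=\begin{pmatrix}0&1&0\\0&0&1\\1&a&0\end{pmatrix},\quad M_{p_2}=\begin{pmatrix}0&0&1\\1&a&0\\0&1&a\end{pmatrix},$$ and for $n\ge 3$: $M_{p_n}=aM_{p_{n-2}}+M_{p_{n-3}}$ if $n$ is even, and $M_{p_n}=bM_{p_{n-2}}+M_{p_{n-3}}$ if $n$ is odd. -}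

module Defs where

open import Level using (Level)
open import Algebra.Bundles using (CommutativeRing)
open import Data.Nat using (ℕ; zero; suc)
open import Data.Fin using (Fin; zero; suc)

module PadovanMatrices {c ℓ : Level} (R : CommutativeRing c ℓ) where
  open CommutativeRing R hiding (zero)

  Mat3 : Set c
  Mat3 = Fin 3 → Fin 3 → Carrier

  _⊗_ : Mat3 → Mat3 → Mat3
  (A ⊗ B) i j = A i zero * B zero j + A i (suc zero) * B (suc zero) j
                + A i (suc (suc zero)) * B (suc (suc zero)) j

  _⊕_ : Mat3 → Mat3 → Mat3
  (A ⊕ B) i j = A i j + B i j

  _·_ : Carrier → Mat3 → Mat3
  (k · A) i j = k * A i j

  _≋_ : Mat3 → Mat3 → Set ℓ
  A ≋ B = ∀ i j → A i j ≈ B i j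

  mat : Carrier → Carrier → Carrier → Carrier → Carrier → Carrier →
        Carrier → Carrier → Carrier → Mat3
  mat x00 x01 x02 x10 x11 x12 x20 x21 x22 = f
    where
    f : Mat3
    f zero zero = x00
    f zero (suc zero) = x01
    f zero (suc (suc zero)) = x02
    f (suc zero) zero = x10
    f (suc zero) (suc zero) = x11
    f (suc zero) (suc (suc zero)) = x12
    f (suc (suc zero)) zero = x20
    f (suc (suc zero)) (suc zero) = x21
    f (suc (suc zero)) (suc (suc zero)) = x22

  sel : ℕ → Carrier → Carrier → Carrier
  sel zero a b = a
  sel (suc zero) a b = b
  sel (suc (suc n)) a b = sel n a b

  M : Carrier → Carrier → ℕ → Mat3
  M a b zero = mat 1# 0# 0# 0# 1# 0# 0# 0# 1#
  M a b (suc zero) = mat 0# 1# 0# 0# 0# 1# 1# a 0#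
  M a b (suc (suc zero)) = mat 0# 0# 1# 1# a 0# 0# 1# a
  M a b (suc (suc (suc n))) =
    (sel (suc (suc (suc n))) a b · M a b (suc n)) ⊕ M a b n

{-# OPTIONS --safe #-}
-- Let P = M a b 1, the companion matrix of t³ − a t − 1; then M a b 0 = I and
-- M a b 2 = P². The span of I, P, P² is closed under the linear recurrence
-- defining M, so every M a b n has the form x I + y P + z P². Such polynomials
-- in P commute pairwise, whatever the value of a.
module Submission where

open import Defs
open import Level using (Level; _⊔_)
open import Algebra.Bundles using (CommutativeRing)
open import Data.Nat using (ℕ; zero; suc)
open import Data.Fin using (zero; suc)
open import Data.Product using (Σ-syntax; _,_)
open import Relation.Binary.Bundles using (Setoid)
import Data.Vec.Functional.Relation.Binary.Equality.Setoid as PointwiseSetoid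
import Relation.Binary.Reasoning.Setoid as SetoidReasoning

module _ {c ℓ : Level} (R : CommutativeRing c ℓ) where
  open CommutativeRing R hiding (zero)
  open PadovanMatrices R
  open import Algebra.Solver.Ring.NaturalCoefficients.Default commutativeSemiring
    using (solve; _:=_; _:+_; _:*_)

  ≋-setoid : Setoid c ℓ
  ≋-setoid = PointwiseSetoid.≋-setoid (PointwiseSetoid.≋-setoid setoid 3) 3

  module ≋-Reasoning = SetoidReasoning ≋-setoid

  ⊗-cong : ∀ {A A′ B B′} → A ≋ A′ → B ≋ B′ → (A ⊗ B) ≋ (A′ ⊗ B′)
  ⊗-cong A≋A′ B≋B′ i j =
    +-cong (+-cong (*-cong (A≋A′ i zero) (B≋B′ zero j))
                   (*-cong (A≋A′ i (suc zero)) (B≋B′ (suc zero) j)))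
           (*-cong (A≋A′ i (suc (suc zero))) (B≋B′ (suc (suc zero)) j))

  ⊕-cong : ∀ {A A′ B B′} → A ≋ A′ → B ≋ B′ → (A ⊕ B) ≋ (A′ ⊕ B′)
  ⊕-cong A≋A′ B≋B′ i j = +-cong (A≋A′ i j) (B≋B′ i j)

  ·-congˡ : ∀ {k A B} → A ≋ B → (k · A) ≋ (k · B)
  ·-congˡ A≋B i j = *-congˡ (A≋B i j)

  mat-cong : ∀ {x₀₀ x₀₁ x₀₂ x₁₀ x₁₁ x₁₂ x₂₀ x₂₁ x₂₂ y₀₀ y₀₁ y₀₂ y₁₀ y₁₁ y₁₂ y₂₀ y₂₁ y₂₂} →
             x₀₀ ≈ y₀₀ → x₀₁ ≈ y₀₁ → x₀₂ ≈ y₀₂ →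
             x₁₀ ≈ y₁₀ → x₁₁ ≈ y₁₁ → x₁₂ ≈ y₁₂ →
             x₂₀ ≈ y₂₀ → x₂₁ ≈ y₂₁ → x₂₂ ≈ y₂₂ →
             mat x₀₀ x₀₁ x₀₂ x₁₀ x₁₁ x₁₂ x₂₀ x₂₁ x₂₂ ≋ mat y₀₀ y₀₁ y₀₂ y₁₀ y₁₁ y₁₂ y₂₀ y₂₁ y₂₂
  mat-cong e₀₀ _ _ _ _ _ _ _ _ zero zero = e₀₀
  mat-cong _ e₀₁ _ _ _ _ _ _ _ zero (suc zero) = e₀₁
  mat-cong _ _ e₀₂ _ _ _ _ _ _ zero (suc (suc zero)) = e₀₂
  mat-cong _ _ _ e₁₀ _ _ _ _ _ (suc zero) zero = e₁₀
  mat-cong _ _ _ _ e₁₁ _ _ _ _ (suc zero) (suc zero) = e₁₁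
  mat-cong _ _ _ _ _ e₁₂ _ _ _ (suc zero) (suc (suc zero)) = e₁₂
  mat-cong _ _ _ _ _ _ e₂₀ _ _ (suc (suc zero)) zero = e₂₀
  mat-cong _ _ _ _ _ _ _ e₂₁ _ (suc (suc zero)) (suc zero) = e₂₁
  mat-cong _ _ _ _ _ _ _ _ e₂₂ (suc (suc zero)) (suc (suc zero)) = e₂₂

  module _ (a : Carrier) where

    -- x I + y P + z P², where P = M a b 1 and P² = M a b 2.
    polyP : Carrier → Carrier → Carrier → Mat3
    polyP x y z = mat x y z z (x + a * z) y y (a * y + z) (x + a * z)

    IsPolyP : Mat3 → Set (c ⊔ ℓ)
    IsPolyP A = Σ[ x ∈ Carrier ] Σ[ y ∈ Carrier ] Σ[ z ∈ Carrier ] A ≋ polyP x y z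

    polyP-comm : ∀ x y z x′ y′ z′ →
                 (polyP x y z ⊗ polyP x′ y′ z′) ≋ (polyP x′ y′ z′ ⊗ polyP x y z)
    polyP-comm x y z x′ y′ z′ zero zero = solve 7
      (λ a x y z x′ y′ z′ → x :* x′ :+ y :* z′ :+ z :* y′
                         := x′ :* x :+ y′ :* z :+ z′ :* y)
      refl a x y z x′ y′ z′
    polyP-comm x y z x′ y′ z′ zero (suc zero) = solve 7
      (λ a x y z x′ y′ z′ → x :* y′ :+ y :* (x′ :+ a :* z′) :+ z :* (a :* y′ :+ z′)
                         := x′ :* y :+ y′ :* (x :+ a :* z) :+ z′ :* (a :* y :+ z))
      refl a x y z x′ y′ z′
    polyP-comm x y z x′ y′ z′ zero (suc (suc zero)) = solve 7
      (λ a x y z x′ y′ z′ → x :* z′ :+ y :* y′ :+ z :* (x′ :+ a :* z′)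
                         := x′ :* z :+ y′ :* y :+ z′ :* (x :+ a :* z))
      refl a x y z x′ y′ z′
    polyP-comm x y z x′ y′ z′ (suc zero) zero = solve 7
      (λ a x y z x′ y′ z′ → z :* x′ :+ (x :+ a :* z) :* z′ :+ y :* y′
                         := z′ :* x :+ (x′ :+ a :* z′) :* z :+ y′ :* y)
      refl a x y z x′ y′ z′
    polyP-comm x y z x′ y′ z′ (suc zero) (suc zero) = solve 7
      (λ a x y z x′ y′ z′ → z :* y′ :+ (x :+ a :* z) :* (x′ :+ a :* z′) :+ y :* (a :* y′ :+ z′)
                         := z′ :* y :+ (x′ :+ a :* z′) :* (x :+ a :* z) :+ y′ :* (a :* y :+ z))
      refl a x y z x′ y′ z′
    polyP-comm x y z x′ y′ z′ (suc zero) (suc (suc zero)) = solve 7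
      (λ a x y z x′ y′ z′ → z :* z′ :+ (x :+ a :* z) :* y′ :+ y :* (x′ :+ a :* z′)
                         := z′ :* z :+ (x′ :+ a :* z′) :* y :+ y′ :* (x :+ a :* z))
      refl a x y z x′ y′ z′
    polyP-comm x y z x′ y′ z′ (suc (suc zero)) zero = solve 7
      (λ a x y z x′ y′ z′ → y :* x′ :+ (a :* y :+ z) :* z′ :+ (x :+ a :* z) :* y′
                         := y′ :* x :+ (a :* y′ :+ z′) :* z :+ (x′ :+ a :* z′) :* y)
      refl a x y z x′ y′ z′
    polyP-comm x y z x′ y′ z′ (suc (suc zero)) (suc zero) = solve 7
      (λ a x y z x′ y′ z′ → y :* y′ :+ (a :* y :+ z) :* (x′ :+ a :* z′) :+ (x :+ a :* z) :* (a :* y′ :+ z′)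
                         := y′ :* y :+ (a :* y′ :+ z′) :* (x :+ a :* z) :+ (x′ :+ a :* z′) :* (a :* y :+ z))
      refl a x y z x′ y′ z′
    polyP-comm x y z x′ y′ z′ (suc (suc zero)) (suc (suc zero)) = solve 7
      (λ a x y z x′ y′ z′ → y :* z′ :+ (a :* y :+ z) :* y′ :+ (x :+ a :* z) :* (x′ :+ a :* z′)
                         := y′ :* z :+ (a :* y′ :+ z′) :* y :+ (x′ :+ a :* z′) :* (x :+ a :* z))
      refl a x y z x′ y′ z′

    linear-diagonal : ∀ s x z x′ z′ →
                      s * (x + a * z) + (x′ + a * z′) ≈ (s * x + x′) + a * (s * z + z′)
    linear-diagonal = solve 6
      (λ a s x z x′ z′ → s :* (x :+ a :* z) :+ (x′ :+ a :* z′) := (s :* x :+ x′) :+ a :* (s :* z :+ z′))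
      refl a

    linear-subdiagonal : ∀ s y z y′ z′ →
                         s * (a * y + z) + (a * y′ + z′) ≈ a * (s * y + y′) + (s * z + z′)
    linear-subdiagonal = solve 6
      (λ a s y z y′ z′ → s :* (a :* y :+ z) :+ (a :* y′ :+ z′) := a :* (s :* y :+ y′) :+ (s :* z :+ z′))
      refl a

    polyP-linear : ∀ s x y z x′ y′ z′ →
                   ((s · polyP x y z) ⊕ polyP x′ y′ z′) ≋ polyP (s * x + x′) (s * y + y′) (s * z + z′)
    polyP-linear s x y z x′ y′ z′ zero zero = refl
    polyP-linear s x y z x′ y′ z′ zero (suc zero) = refl
    polyP-linear s x y z x′ y′ z′ zero (suc (suc zero)) = refl
    polyP-linear s x y z x′ y′ z′ (suc zero) zero = refl
    polyP-linear s x y z x′ y′ z′ (suc zero) (suc zero) = linear-diagonal s x z x′ z′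
    polyP-linear s x y z x′ y′ z′ (suc zero) (suc (suc zero)) = refl
    polyP-linear s x y z x′ y′ z′ (suc (suc zero)) zero = refl
    polyP-linear s x y z x′ y′ z′ (suc (suc zero)) (suc zero) = linear-subdiagonal s y z y′ z′
    polyP-linear s x y z x′ y′ z′ (suc (suc zero)) (suc (suc zero)) = linear-diagonal s x z x′ z′

    IsPolyP-comm : ∀ {A B} → IsPolyP A → IsPolyP B → (A ⊗ B) ≋ (B ⊗ A)
    IsPolyP-comm {A} {B} (x , y , z , A≋) (x′ , y′ , z′ , B≋) = begin
      A ⊗ B                          ≈⟨ ⊗-cong A≋ B≋ ⟩
      polyP x y z ⊗ polyP x′ y′ z′   ≈⟨ polyP-comm x y z x′ y′ z′ ⟩
      polyP x′ y′ z′ ⊗ polyP x y z   ≈⟨ ⊗-cong B≋ A≋ ⟨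
      B ⊗ A                          ∎
      where open ≋-Reasoning

    IsPolyP-linear : ∀ s {A B} → IsPolyP A → IsPolyP B → IsPolyP ((s · A) ⊕ B)
    IsPolyP-linear s (x , y , z , A≋) (x′ , y′ , z′ , B≋) =
      s * x + x′ , s * y + y′ , s * z + z′ ,
      Setoid.trans ≋-setoid (⊕-cong (·-congˡ A≋) B≋) (polyP-linear s x y z x′ y′ z′)

    x+a*0≈x : ∀ x → x + a * 0# ≈ x
    x+a*0≈x x = trans (+-congˡ (zeroʳ a)) (+-identityʳ x)

    a*0+x≈x : ∀ x → a * 0# + x ≈ x
    a*0+x≈x x = trans (+-congʳ (zeroʳ a)) (+-identityˡ x)

    0+a*1≈a : 0# + a * 1# ≈ a
    0+a*1≈a = trans (+-identityˡ (a * 1#)) (*-identityʳ a)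

    a*1+0≈a : a * 1# + 0# ≈ a
    a*1+0≈a = trans (+-identityʳ (a * 1#)) (*-identityʳ a)

    M-IsPolyP : ∀ b n → IsPolyP (M a b n)
    M-IsPolyP b zero = 1# , 0# , 0# ,
      mat-cong refl refl refl refl (sym (x+a*0≈x 1#)) refl refl (sym (a*0+x≈x 0#)) (sym (x+a*0≈x 1#))
    M-IsPolyP b (suc zero) = 0# , 1# , 0# ,
      mat-cong refl refl refl refl (sym (x+a*0≈x 0#)) refl refl (sym a*1+0≈a) (sym (x+a*0≈x 0#))
    M-IsPolyP b (suc (suc zero)) = 0# , 0# , 1# ,
      mat-cong refl refl refl refl (sym 0+a*1≈a) refl refl (sym (a*0+x≈x 1#)) (sym 0+a*1≈a)
    M-IsPolyP b (suc (suc (suc n))) =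
      IsPolyP-linear (sel (suc (suc (suc n))) a b) (M-IsPolyP b (suc n)) (M-IsPolyP b n)

  M-comm : ∀ a b n m → (M a b n ⊗ M a b m) ≋ (M a b m ⊗ M a b n)
  M-comm a b n m = IsPolyP-comm a (M-IsPolyP a b n) (M-IsPolyP a b m)

corollary2p3 : ∀ {c ℓ} (R : CommutativeRing c ℓ) →
    let open CommutativeRing R
        open PadovanMatrices R
    in (b : Carrier) (n m : ℕ) →
       (M (1# + 1#) b n ⊗ M (1# + 1#) b m) ≋ (M (1# + 1#) b m ⊗ M (1# + 1#) b n)
corollary2p3 R = M-comm R (1# + 1#)
  where open CommutativeRing R
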